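{- Let $k\geq m\geq 1$ and $n\geq k+1$. Then the number of ordered preference sets of length $n$ with exactly $k$ flaws and leading term $a_1=m$ is $op_{n,k}^m=\frac{2k-m+4}{2n-m}\binom{2n-m}{n-k-2}$.
   Context: Parking model: $n$ parking spaces numbered $1,\dots,n$ from left to right; a preference set of length $n$ is a sequence $(a_1,\dots,a_n)$ with $a_i\in[n]$. Cars arrive in order; car $i$ goes to space $a_i$, and if it is occupied, moves to the first unoccupied space to the right; if there is none, the car cannot park. The number of flaws is the number of cars that cannot park. A preference set is ordered if $a_1\leq\cdots\leq a_n$; its leading term is $a_1$. Binomial coefficients with negative lower index are $0$. -}

module Defs where

open import Data.Nat using (ℕ; zero; suc; _+_; _*_; _∸_; _≤ᵇ_)
open import Data.Nat.Combinatorics using (_C_)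
open import Data.Bool using (Bool; true; false; if_then_else_; _∧_)
open import Data.List using (List; []; _∷_; map; concatMap; length; applyUpTo)
open import Data.Product using (_×_; _,_)
open import Data.Integer using (ℤ; +_; -[1+_])

allSeqs : ℕ → ℕ → List (List ℕ)
allSeqs n zero = [] ∷ []
allSeqs n (suc len) =
  concatMap (λ a → map (a ∷_) (allSeqs n len)) (applyUpTo suc n)

preferenceSets : ℕ → List (List ℕ)
preferenceSets n = allSeqs n n

-- A lot is a list of Bools (true = occupied) for spaces 1,2,…  (left to right).
-- parkFrom i lot : a car arriving at space i (1-based) parks at the first
-- unoccupied space ≥ i; returns whether it parked, and the new lot.
parkFrom : ℕ → List Bool → Bool × List Bool
parkFrom (suc i) [] = false , []
parkFrom zero lot = false , lot   -- never used: preferences are ≥ 1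
parkFrom (suc zero) (false ∷ lot) = true , (true ∷ lot)
parkFrom (suc zero) (true ∷ lot) with parkFrom 1 lot
... | (ok , lot') = ok , (true ∷ lot')
parkFrom (suc (suc i)) (b ∷ lot) with parkFrom (suc i) lot
... | (ok , lot') = ok , (b ∷ lot')

flawsFrom : List Bool → List ℕ → ℕ
flawsFrom lot [] = 0
flawsFrom lot (a ∷ as) with parkFrom a lot
... | (true , lot') = flawsFrom lot' as
... | (false , lot') = suc (flawsFrom lot' as)

emptyLot : ℕ → List Bool
emptyLot zero = []
emptyLot (suc n) = false ∷ emptyLot n

flaws : ℕ → List ℕ → ℕ
flaws n as = flawsFrom (emptyLot n) as

isOrdered : List ℕ → Bool
isOrdered [] = true
isOrdered (a ∷ []) = true
isOrdered (a ∷ b ∷ as) = (a ≤ᵇ b) ∧ isOrdered (b ∷ as)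

leadingIs : ℕ → List ℕ → Bool
leadingIs m [] = false
leadingIs m (a ∷ as) = (m ≤ᵇ a) ∧ (a ≤ᵇ m)

count : {A : Set} → (A → Bool) → List A → ℕ
count p [] = 0
count p (x ∷ xs) = if p x then suc (count p xs) else count p xs

op : ℕ → ℕ → ℕ → ℕ
op n k m = count (λ as → isOrdered as ∧ leadingIs m as ∧ (k ≤ᵇ flaws n as) ∧ (flaws n as ≤ᵇ k))
                 (preferenceSets n)

binomℤ : ℕ → ℤ → ℕ
binomℤ a (+ j) = a C j
binomℤ a -[1+ j ] = 0

module Submission where

open import Defs
open import Data.Nat using (ℕ; _+_; _*_; _∸_; _≤_)
open import Data.Integer using (ℤ; +_; _-_)
open import Relation.Binary.PropositionalEquality using (_≡_)

open import Data.Nat using (zero; suc; _<_; z≤n; s≤s; _≤ᵇ_; _<ᵇ_; _≡ᵇ_)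
open import Data.Nat.Properties
open import Data.Nat.Combinatorics using (_C_; nCk+nC[k+1]≡[n+1]C[k+1]; k>n⇒nCk≡0; nC1≡n; nCn≡1)
open import Data.Nat.Tactic.RingSolver using (solve-∀)
open import Algebra.Properties.CommutativeSemigroup +-commutativeSemigroup
  using (interchange; xy∙z≈xz∙y; x∙yz≈xz∙y)
open import Data.Integer using (_⊖_)
open import Data.Integer.Properties using ([+m]-[+n]≡m⊖n; +-cancelˡ-⊖; [1+m]⊖[1+n]≡m⊖n)
open import Data.Bool using (Bool; true; false; _∧_)
open import Data.Bool.Properties using (∧-zeroʳ)
open import Data.List using (List; []; _∷_; _++_; map; concatMap; applyUpTo; length; replicate)
open import Data.List.Properties using (length-++; length-++-≤ˡ; length-replicate; ++-assoc)
open import Data.Product using (_,_; proj₂; map₂)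
open import Function using (_⟨_⟩_)
open import Relation.Binary.PropositionalEquality
open import Relation.Nullary using (yes; no)
open import Relation.Nullary.Decidable using (dec-true; dec-false)

-- In an ordered preference set the occupied spaces from the last preferred space onwards always
-- form one block followed by free spaces only, so after the first car (parked at m) the process
-- is described by the block length, the number of free spaces after it and the flaws still to
-- come.  The number nTails of ordered tails from such a state satisfies an explicit recurrence,
-- which hockey-stick identities solve: with p + j cars left, more than p free spaces and j ≥ 1
-- flaws to come there are C(N,p−1) − C(N,p−2) tails.  For the theorem j = k, p = n − k − 1 and
-- N = 2n − m − 1, and the ballot identity (C(N,q) − C(N,q−1))(N+1) = (N+1−2q) C(N+1,q) gives
-- the formula.

sumBelow : (ℕ → ℕ) → ℕ → ℕ
sumBelow f zero = 0
sumBelow f (suc n) = sumBelow f n + f n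

sumBelow-cong : ∀ {f g} n → (∀ i → i < n → f i ≡ g i) → sumBelow f n ≡ sumBelow g n
sumBelow-cong zero eq = refl
sumBelow-cong (suc n) eq = cong₂ _+_ (sumBelow-cong n (λ i i<n → eq i (m<n⇒m<1+n i<n))) (eq n ≤-refl)

sumBelow-zero : ∀ {f} n → (∀ i → i < n → f i ≡ 0) → sumBelow f n ≡ 0
sumBelow-zero zero eq = refl
sumBelow-zero (suc n) eq =
  cong₂ _+_ (sumBelow-zero n (λ i i<n → eq i (m<n⇒m<1+n i<n))) (eq n ≤-refl)

sumBelow-single : ∀ {f} n {i} → i < n → (∀ j → j < n → j ≢ i → f j ≡ 0) → sumBelow f n ≡ f i
sumBelow-single {f} (suc n) {i} i<1+n zero-elsewhere with i ≟ n
... | yes refl = cong (_+ f i) (sumBelow-zero n λ j j<n → zero-elsewhere j (m<n⇒m<1+n j<n) (<⇒≢ j<n))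
... | no i≢n =
  cong₂ _+_ (sumBelow-single n (≤∧≢⇒< (m<1+n⇒m≤n i<1+n) i≢n) λ j j<n →
               zero-elsewhere j (m<n⇒m<1+n j<n))
            (zero-elsewhere n ≤-refl (≢-sym i≢n)) ⟨ trans ⟩
  +-identityʳ (f i)

sumBelow-+ : ∀ {f g h} n → (∀ i → i < n → f i + g i ≡ h i) →
             sumBelow f n + sumBelow g n ≡ sumBelow h n
sumBelow-+ zero eq = refl
sumBelow-+ {f} {g} (suc n) eq =
  interchange (sumBelow f n) (f n) (sumBelow g n) (g n) ⟨ trans ⟩
  cong₂ _+_ (sumBelow-+ n (λ i i<n → eq i (m<n⇒m<1+n i<n))) (eq n ≤-refl)

sumBelow-suc : ∀ f n → sumBelow f (suc n) ≡ f 0 + sumBelow (λ i → f (suc i)) n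
sumBelow-suc f zero = +-comm 0 (f 0)
sumBelow-suc f (suc n) = cong (_+ f (suc n)) (sumBelow-suc f n) ⟨ trans ⟩ +-assoc (f 0) _ _

sumBelow-split : ∀ f a b → sumBelow f (a + b) ≡ sumBelow f a + sumBelow (λ i → f (a + i)) b
sumBelow-split f a zero = cong (sumBelow f) (+-identityʳ a) ⟨ trans ⟩ sym (+-identityʳ _)
sumBelow-split f a (suc b) = begin
  sumBelow f (a + suc b)                                        ≡⟨ cong (sumBelow f) (+-suc a b) ⟩
  sumBelow f (a + b) + f (a + b)                                ≡⟨ cong (_+ f (a + b)) (sumBelow-split f a b) ⟩
  sumBelow f a + sumBelow (λ i → f (a + i)) b + f (a + b)       ≡⟨ +-assoc (sumBelow f a) _ _ ⟩
  sumBelow f a + sumBelow (λ i → f (a + i)) (suc b)             ∎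
  where open ≡-Reasoning

sumBelow-reverse : ∀ f n → sumBelow (λ i → f (n ∸ i)) (suc n) ≡ sumBelow f (suc n)
sumBelow-reverse f zero = refl
sumBelow-reverse f (suc n) = begin
  sumBelow (λ i → f (suc n ∸ i)) (suc (suc n))  ≡⟨ sumBelow-suc (λ i → f (suc n ∸ i)) (suc n) ⟩
  f (suc n) + sumBelow (λ i → f (n ∸ i)) (suc n) ≡⟨ cong (_+_ (f (suc n))) (sumBelow-reverse f n) ⟩
  f (suc n) + sumBelow f (suc n)                 ≡⟨ +-comm (f (suc n)) _ ⟩
  sumBelow f (suc (suc n))                       ∎
  where open ≡-Reasoning

+-combine₃ : ∀ {a₁ a₂ a₃ b₁ b₂ b₃ c₁ c₂ c₃} → a₁ + b₁ ≡ c₁ → a₂ + b₂ ≡ c₂ → a₃ + b₃ ≡ c₃ →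
             (a₁ + (a₂ + a₃)) + (b₁ + (b₂ + b₃)) ≡ c₁ + (c₂ + c₃)
+-combine₃ {a₁} {a₂} {a₃} {b₁} {b₂} {b₃} refl refl refl =
  interchange a₁ (a₂ + a₃) b₁ (b₂ + b₃) ⟨ trans ⟩ cong (_+_ (a₁ + b₁)) (interchange a₂ a₃ b₂ b₃)


-- Pascal families and binomial identities

Pascal : (ℕ → ℕ → ℕ) → Set
Pascal F = ∀ N t → F (suc N) (suc t) ≡ F N (suc t) + F N t

module _ {F : ℕ → ℕ → ℕ} (pascal : Pascal F) where

  column-hockeyStick : ∀ K t D → sumBelow (λ e → F (K + e) t) D + F K (suc t) ≡ F (K + D) (suc t)
  column-hockeyStick K t zero = cong (λ x → F x (suc t)) (sym (+-identityʳ K))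
  column-hockeyStick K t (suc D) = begin
    sumBelow G D + F (K + D) t + F K (suc t)    ≡⟨ xy∙z≈xz∙y (sumBelow G D) _ _ ⟩
    sumBelow G D + F K (suc t) + F (K + D) t    ≡⟨ cong (_+ F (K + D) t) (column-hockeyStick K t D) ⟩
    F (K + D) (suc t) + F (K + D) t             ≡⟨ pascal (K + D) t ⟨
    F (suc (K + D)) (suc t)                     ≡⟨ cong (λ x → F x (suc t)) (+-suc K D) ⟨
    F (K + suc D) (suc t)                       ∎
    where
    open ≡-Reasoning
    G = λ e → F (K + e) t

  column-hockeyStick-split : ∀ L W D t →
    F (L + W + D) (suc t) ≡
    sumBelow (λ e → F (L + W + e) t) D + (sumBelow (λ i → F (L + i) t) W + F L (suc t))
  column-hockeyStick-split L W D t =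
    sym (column-hockeyStick (L + W) t D) ⟨ trans ⟩
    cong (_+_ (sumBelow (λ e → F (L + W + e) t) D)) (sym (column-hockeyStick L t W))

  diagonal-hockeyStick : ∀ M c D →
    sumBelow (λ e → F (M + e) (suc (c + e))) D + F M c ≡ F (M + D) (c + D)
  diagonal-hockeyStick M c zero = cong₂ F (sym (+-identityʳ M)) (sym (+-identityʳ c))
  diagonal-hockeyStick M c (suc D) = begin
    sumBelow G D + G D + F M c      ≡⟨ xy∙z≈xz∙y (sumBelow G D) _ _ ⟩
    sumBelow G D + F M c + G D      ≡⟨ cong (_+ G D) (diagonal-hockeyStick M c D) ⟩
    F (M + D) (c + D) + G D         ≡⟨ +-comm (F (M + D) (c + D)) _ ⟩
    G D + F (M + D) (c + D)         ≡⟨ pascal (M + D) (c + D) ⟨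
    F (suc (M + D)) (suc (c + D))   ≡⟨ cong₂ F (+-suc M D) (+-suc c D) ⟨
    F (M + suc D) (c + suc D)       ∎
    where
    open ≡-Reasoning
    G = λ e → F (M + e) (suc (c + e))

-- shiftC s N i = C(N, i − s), which vanishes for i < s.
shiftC : ℕ → ℕ → ℕ → ℕ
shiftC zero    N i       = N C i
shiftC (suc s) N zero    = 0
shiftC (suc s) N (suc i) = shiftC s N i

shiftC-suc : ∀ s N i → shiftC s (suc N) i ≡ shiftC s N i + shiftC (suc s) N i
shiftC-suc zero N zero = refl
shiftC-suc zero N (suc i) = sym (nCk+nC[k+1]≡[n+1]C[k+1] N i) ⟨ trans ⟩ +-comm (N C i) _
shiftC-suc (suc s) N zero = refl
shiftC-suc (suc s) N (suc i) = shiftC-suc s N i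

shiftC-pascal : ∀ s → Pascal (shiftC s)
shiftC-pascal s N t = shiftC-suc s N (suc t)

C-absorption : ∀ n k → k * (suc n C k) ≡ suc n * shiftC 1 n k
C-absorption n zero = sym (*-zeroʳ (suc n))
C-absorption n (suc zero) = +-identityʳ _ ⟨ trans ⟩ nC1≡n (suc n) ⟨ trans ⟩ sym (*-identityʳ (suc n))
C-absorption zero (suc (suc k)) =
  cong (suc (suc k) *_) (k>n⇒nCk≡0 {1} {suc (suc k)} (s≤s (s≤s z≤n))) ⟨ trans ⟩ *-zeroʳ (suc (suc k))
C-absorption (suc n) (suc (suc k)) = begin
  suc (suc k) * (suc (suc n) C suc (suc k))
    ≡⟨ cong (suc (suc k) *_) (shiftC-suc 0 (suc n) (suc (suc k))) ⟩
  suc (suc k) * (A + B)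
    ≡⟨ regroup (suc k) A B ⟩
  suc (suc k) * A + suc k * B + B
    ≡⟨ cong (_+ B) (cong₂ _+_ (C-absorption n (suc (suc k))) (C-absorption n (suc k))) ⟩
  suc n * (n C suc k) + suc n * (n C k) + B
    ≡⟨ cong (_+ B) (*-distribˡ-+ (suc n) (n C suc k) (n C k)) ⟨
  suc n * (n C suc k + n C k) + B
    ≡⟨ cong (λ x → suc n * x + B) (shiftC-suc 0 n (suc k)) ⟨
  suc n * B + B
    ≡⟨ +-comm (suc n * B) B ⟩
  suc (suc n) * B ∎
  where
  open ≡-Reasoning
  A = suc n C suc (suc k)
  B = suc n C suc k
  regroup : ∀ k a b → suc k * (a + b) ≡ suc k * a + k * b + b
  regroup = solve-∀

-- The ballot identity, with h = C(N,q) − C(N,q−1) and c = N + 1 − 2q given by equations.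
ballot : ∀ N q h c → h + shiftC 1 N q ≡ N C q → c + q + q ≡ suc N →
         h * suc N ≡ c * (suc N C q)
ballot N q h c difference total = +-cancelʳ-≡ (q * B + q * B) (h * S) (c * B) (begin
  h * S + (q * B + q * B)    ≡⟨ cong (λ x → h * S + (x + x)) (C-absorption N q) ⟩
  h * S + (S * Y + S * Y)    ≡⟨ expand₁ h S Y ⟩
  S * (h + Y + Y)            ≡⟨ cong (λ x → S * (x + Y)) difference ⟩
  S * (N C q + Y)            ≡⟨ cong (S *_) (shiftC-suc 0 N q) ⟨
  S * B                      ≡⟨ cong (_* B) total ⟨
  (c + q + q) * B            ≡⟨ expand₂ c q B ⟩
  c * B + (q * B + q * B)    ∎)
  where
  open ≡-Reasoning
  S = suc N
  B = suc N C q
  Y = shiftC 1 N q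
  expand₁ : ∀ h S Y → h * S + (S * Y + S * Y) ≡ S * (h + Y + Y)
  expand₁ = solve-∀
  expand₂ : ∀ c q B → (c + q + q) * B ≡ c * B + (q * B + q * B)
  expand₂ = solve-∀


count-++ : ∀ {A : Set} (p : A → Bool) xs ys → count p (xs ++ ys) ≡ count p xs + count p ys
count-++ p [] ys = refl
count-++ p (x ∷ xs) ys with p x
... | true  = cong suc (count-++ p xs ys)
... | false = count-++ p xs ys

count-map : ∀ {A B : Set} (p : B → Bool) (f : A → B) xs → count p (map f xs) ≡ count (λ x → p (f x)) xs
count-map p f [] = refl
count-map p f (x ∷ xs) with p (f x)
... | true  = cong suc (count-map p f xs)
... | false = count-map p f xs

count-cong : ∀ {A : Set} {p q : A → Bool} xs → (∀ x → p x ≡ q x) → count p xs ≡ count q xs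
count-cong [] eq = refl
count-cong {q = q} (x ∷ xs) eq rewrite eq x with q x
... | true  = cong suc (count-cong xs eq)
... | false = count-cong xs eq

count-false : ∀ {A : Set} {p : A → Bool} xs → (∀ x → p x ≡ false) → count p xs ≡ 0
count-false [] eq = refl
count-false (x ∷ xs) eq rewrite eq x = count-false xs eq

count-concatMap-applyUpTo : ∀ {A B : Set} (p : B → Bool) (g : A → List B) f n →
  count p (concatMap g (applyUpTo f n)) ≡ sumBelow (λ i → count p (g (f i))) n
count-concatMap-applyUpTo p g f zero = refl
count-concatMap-applyUpTo p g f (suc n) = begin
  count p (g (f 0) ++ concatMap g (applyUpTo (λ i → f (suc i)) n))
    ≡⟨ count-++ p (g (f 0)) _ ⟩
  count p (g (f 0)) + count p (concatMap g (applyUpTo (λ i → f (suc i)) n))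
    ≡⟨ cong (_+_ (count p (g (f 0)))) (count-concatMap-applyUpTo p g (λ i → f (suc i)) n) ⟩
  count p (g (f 0)) + sumBelow (λ i → count p (g (f (suc i)))) n
    ≡⟨ sumBelow-suc (λ i → count p (g (f i))) n ⟨
  sumBelow (λ i → count p (g (f i))) (suc n) ∎
  where open ≡-Reasoning

count-allSeqs : ∀ (p : List ℕ → Bool) n r →
  count p (allSeqs n (suc r)) ≡ sumBelow (λ i → count (λ s → p (suc i ∷ s)) (allSeqs n r)) n
count-allSeqs p n r =
  count-concatMap-applyUpTo p (λ a → map (a ∷_) (allSeqs n r)) suc n ⟨ trans ⟩
  sumBelow-cong n (λ i _ → count-map p (suc i ∷_) (allSeqs n r))

≤ᵇ-true : ∀ {m n} → m ≤ n → (m ≤ᵇ n) ≡ true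
≤ᵇ-true {m} {n} = dec-true (m ≤? n)

≤ᵇ-false : ∀ {m n} → n < m → (m ≤ᵇ n) ≡ false
≤ᵇ-false {m} {n} n<m = dec-false (m ≤? n) (<⇒≱ n<m)

≤ᵇ∧≥ᵇ≡≡ᵇ : ∀ m n → ((m ≤ᵇ n) ∧ (n ≤ᵇ m)) ≡ (m ≡ᵇ n)
≤ᵇ∧≥ᵇ≡≡ᵇ zero zero = refl
≤ᵇ∧≥ᵇ≡≡ᵇ zero (suc n) = refl
≤ᵇ∧≥ᵇ≡≡ᵇ (suc m) zero = refl
≤ᵇ∧≥ᵇ≡≡ᵇ (suc m) (suc n) = cong₂ _∧_ (<ᵇ-suc m n) (<ᵇ-suc n m) ⟨ trans ⟩ ≤ᵇ∧≥ᵇ≡≡ᵇ m n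
  where
  <ᵇ-suc : ∀ a b → (a <ᵇ suc b) ≡ (a ≤ᵇ b)
  <ᵇ-suc zero b = refl
  <ᵇ-suc (suc a) b = refl


-- Parking on a lot of shape prefix, occupied block, free spaces

replicate-+ : ∀ {A : Set} a b (x : A) → replicate (a + b) x ≡ replicate a x ++ replicate b x
replicate-+ zero b x = refl
replicate-+ (suc a) b x = cong (x ∷_) (replicate-+ a b x)

length-++-replicate : ∀ {A : Set} (xs : List A) i x → length (xs ++ replicate i x) ≡ length xs + i
length-++-replicate xs i x = length-++ xs ⟨ trans ⟩ cong (_+_ (length xs)) (length-replicate i)

parkFrom-length : ∀ {a lot b lot'} → parkFrom a lot ≡ (b , lot') → length lot' ≡ length lot
parkFrom-length {a} {lot} eq = cong (λ p → length (proj₂ p)) (sym eq) ⟨ trans ⟩ preserves a lot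
  where
  preserves : ∀ a lot → length (proj₂ (parkFrom a lot)) ≡ length lot
  preserves zero lot = refl
  preserves (suc i) [] = refl
  preserves (suc zero) (false ∷ lot) = refl
  preserves (suc zero) (true ∷ lot) with parkFrom 1 lot | preserves 1 lot
  ... | _ , lot' | eq = cong suc eq
  preserves (suc (suc i)) (b ∷ lot) with parkFrom (suc i) lot | preserves (suc i) lot
  ... | _ , lot' | eq = cong suc eq

parkFrom-beyond : ∀ pre rest → parkFrom (suc (length pre)) (pre ++ rest) ≡ map₂ (pre ++_) (parkFrom 1 rest)
parkFrom-beyond [] rest = refl
parkFrom-beyond (b ∷ pre) rest rewrite parkFrom-beyond pre rest = refl

parkFrom-pastBlock : ∀ e rest →
  parkFrom 1 (replicate e true ++ false ∷ rest) ≡ (true , replicate (suc e) true ++ rest)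
parkFrom-pastBlock zero rest = refl
parkFrom-pastBlock (suc e) rest rewrite parkFrom-pastBlock e rest = refl

parkFrom-fullBlock : ∀ e → parkFrom 1 (replicate e true ++ []) ≡ (false , replicate e true ++ [])
parkFrom-fullBlock zero = refl
parkFrom-fullBlock (suc e) rewrite parkFrom-fullBlock e = refl

-- The lot in the state (d, u) of nTails below, when the last car preferred space suc (length pre).
lotState : List Bool → ℕ → ℕ → List Bool
lotState pre d u = pre ++ (replicate (suc d) true ++ replicate u false)

length-lotState : ∀ pre d u → length (lotState pre d u) ≡ length pre + (suc d + u)
length-lotState pre d u =
  length-++ pre ⟨ trans ⟩
  cong (_+_ (length pre)) (length-++-replicate (replicate (suc d) true) u false ⟨ trans ⟩
                           cong (_+ u) (length-replicate (suc d)))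

lotState-splitBlock : ∀ pre i e u →
  lotState pre (i + e) u ≡ (pre ++ replicate i true) ++ (replicate (suc e) true ++ replicate u false)
lotState-splitBlock pre i e u = begin
  pre ++ (replicate (suc (i + e)) true ++ R)
    ≡⟨ cong (λ x → pre ++ (replicate x true ++ R)) (+-suc i e) ⟨
  pre ++ (replicate (i + suc e) true ++ R)
    ≡⟨ cong (λ x → pre ++ (x ++ R)) (replicate-+ i (suc e) true) ⟩
  pre ++ ((replicate i true ++ replicate (suc e) true) ++ R)
    ≡⟨ cong (pre ++_) (++-assoc (replicate i true) _ R) ⟩
  pre ++ (replicate i true ++ (replicate (suc e) true ++ R))
    ≡⟨ ++-assoc pre (replicate i true) _ ⟨
  (pre ++ replicate i true) ++ (replicate (suc e) true ++ R) ∎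
  where
  open ≡-Reasoning
  R = replicate u false

lotState-splitFree : ∀ pre d g w →
  lotState pre d (suc (g + w)) ≡
  (pre ++ (replicate (suc d) true ++ replicate g false)) ++ (false ∷ replicate w false)
lotState-splitFree pre d g w = begin
  pre ++ (B ++ replicate (suc (g + w)) false)  ≡⟨ cong (λ x → pre ++ (B ++ replicate x false)) (+-suc g w) ⟨
  pre ++ (B ++ replicate (g + suc w) false)    ≡⟨ cong (λ x → pre ++ (B ++ x)) (replicate-+ g (suc w) false) ⟩
  pre ++ (B ++ (replicate g false ++ F))       ≡⟨ cong (pre ++_) (++-assoc B (replicate g false) F) ⟨
  pre ++ ((B ++ replicate g false) ++ F)       ≡⟨ ++-assoc pre (B ++ replicate g false) F ⟨
  (pre ++ (B ++ replicate g false)) ++ F       ∎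
  where
  open ≡-Reasoning
  B = replicate (suc d) true
  F = false ∷ replicate w false

parkFrom-inBlock : ∀ pre i e u →
  parkFrom (suc (length (pre ++ replicate i true))) (lotState pre (i + e) (suc u)) ≡
  (true , lotState (pre ++ replicate i true) (suc e) u)
parkFrom-inBlock pre i e u =
  cong (parkFrom _) (lotState-splitBlock pre i e (suc u)) ⟨ trans ⟩
  parkFrom-beyond (pre ++ replicate i true) _ ⟨ trans ⟩
  cong (map₂ ((pre ++ replicate i true) ++_)) (parkFrom-pastBlock (suc e) (replicate u false))

parkFrom-inFullBlock : ∀ pre i e →
  parkFrom (suc (length (pre ++ replicate i true))) (lotState pre (i + e) 0) ≡
  (false , lotState (pre ++ replicate i true) e 0)
parkFrom-inFullBlock pre i e =
  cong (parkFrom _) (lotState-splitBlock pre i e 0) ⟨ trans ⟩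
  parkFrom-beyond (pre ++ replicate i true) _ ⟨ trans ⟩
  cong (map₂ ((pre ++ replicate i true) ++_)) (parkFrom-fullBlock (suc e))

parkFrom-inFree : ∀ pre d g w →
  parkFrom (suc (length (pre ++ (replicate (suc d) true ++ replicate g false)))) (lotState pre d (suc (g + w))) ≡
  (true , lotState (pre ++ (replicate (suc d) true ++ replicate g false)) 0 w)
parkFrom-inFree pre d g w =
  cong (parkFrom _) (lotState-splitFree pre d g w) ⟨ trans ⟩
  parkFrom-beyond (pre ++ (replicate (suc d) true ++ replicate g false)) _

emptyLot-replicate : ∀ n → emptyLot n ≡ replicate n false
emptyLot-replicate zero = refl
emptyLot-replicate (suc n) = cong (false ∷_) (emptyLot-replicate n)

parkFrom-emptyLot : ∀ m' u →
  parkFrom (suc m') (emptyLot (m' + suc u)) ≡ (true , lotState (replicate m' false) 0 u)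
parkFrom-emptyLot zero u = cong (λ lot → true , true ∷ lot) (emptyLot-replicate u)
parkFrom-emptyLot (suc m') u rewrite parkFrom-emptyLot m' u = refl


-- Ordered tails and their recurrence

-- nTails r d u j counts the ordered tails of r cars causing exactly j flaws when the spaces
-- from the last preferred one on are d + 1 occupied spaces followed by u free ones.  A car
-- preferring the a-th occupied space parks just after the block, or is a flaw if u = 0; a car
-- preferring the (g+1)-th free space leaves the g free spaces before it empty for good.
nTails : ℕ → ℕ → ℕ → ℕ → ℕ
nTails zero    d u       zero    = 1
nTails zero    d u       (suc j) = 0
nTails (suc r) d zero    zero    = 0
nTails (suc r) d zero    (suc j) = sumBelow (λ a → nTails r (d ∸ a) zero j) (suc d)
nTails (suc r) d (suc u) j       =
  sumBelow (λ a → nTails r (suc (d ∸ a)) u j) (suc d) + sumBelow (λ g → nTails r zero (u ∸ g) j) (suc u)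

orderedWithFlaws : List Bool → ℕ → List ℕ → Bool
orderedWithFlaws lot j as = isOrdered as ∧ (j ≡ᵇ flawsFrom lot as)

orderedTail : ℕ → List Bool → ℕ → List ℕ → Bool
orderedTail ℓ lot j s = isOrdered (ℓ ∷ s) ∧ (j ≡ᵇ flawsFrom lot s)

orderedTail-below : ∀ {ℓ a lot j s} → a < ℓ → orderedTail ℓ lot j (a ∷ s) ≡ false
orderedTail-below a<ℓ rewrite ≤ᵇ-false a<ℓ = refl

orderedTail-from : ∀ {ℓ a lot j s} → ℓ ≤ a → orderedTail ℓ lot j (a ∷ s) ≡ orderedWithFlaws lot j (a ∷ s)
orderedTail-from ℓ≤a rewrite ≤ᵇ-true ℓ≤a = refl

orderedWithFlaws-parks : ∀ {a lot lot' j s} → parkFrom a lot ≡ (true , lot') →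
                         orderedWithFlaws lot j (a ∷ s) ≡ orderedTail a lot' j s
orderedWithFlaws-parks eq rewrite eq = refl

orderedWithFlaws-flaw : ∀ {a lot lot' j s} → parkFrom a lot ≡ (false , lot') →
                        orderedWithFlaws lot (suc j) (a ∷ s) ≡ orderedTail a lot' j s
orderedWithFlaws-flaw eq rewrite eq = refl

orderedWithFlaws-flaw-0 : ∀ {a lot lot' s} → parkFrom a lot ≡ (false , lot') →
                          orderedWithFlaws lot 0 (a ∷ s) ≡ false
orderedWithFlaws-flaw-0 {a} {s = s} eq rewrite eq = ∧-zeroʳ (isOrdered (a ∷ s))

tailsFrom : ℕ → ℕ → ℕ → List Bool → ℕ → ℕ → ℕ
tailsFrom n r ℓ lot j a = count (λ s → orderedTail ℓ lot j (a ∷ s)) (allSeqs n r)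

tailsFrom-parks : ∀ {n r ℓ a lot lot' j} → ℓ ≤ a → parkFrom a lot ≡ (true , lot') →
                  tailsFrom n r ℓ lot j a ≡ count (orderedTail a lot' j) (allSeqs n r)
tailsFrom-parks {n} {r} {lot = lot} {j = j} ℓ≤a eq = count-cong (allSeqs n r) λ s →
  orderedTail-from {lot = lot} {j} {s} ℓ≤a ⟨ trans ⟩ orderedWithFlaws-parks {j = j} {s} eq

tailsFrom-flaw : ∀ {n r ℓ a lot lot' j} → ℓ ≤ a → parkFrom a lot ≡ (false , lot') →
                 tailsFrom n r ℓ lot (suc j) a ≡ count (orderedTail a lot' j) (allSeqs n r)
tailsFrom-flaw {n} {r} {lot = lot} {j = j} ℓ≤a eq = count-cong (allSeqs n r) λ s →
  orderedTail-from {lot = lot} {suc j} {s} ℓ≤a ⟨ trans ⟩ orderedWithFlaws-flaw {j = j} {s} eq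

tailsFrom-flaw-0 : ∀ {n r ℓ a lot lot'} → ℓ ≤ a → parkFrom a lot ≡ (false , lot') →
                   tailsFrom n r ℓ lot 0 a ≡ 0
tailsFrom-flaw-0 {n} {r} {lot = lot} ℓ≤a eq = count-false (allSeqs n r) λ s →
  orderedTail-from {lot = lot} {0} {s} ℓ≤a ⟨ trans ⟩ orderedWithFlaws-flaw-0 {s = s} eq

count-orderedTail-byFirst : ∀ n r pre d u j → length (lotState pre d u) ≡ n →
  count (orderedTail (suc (length pre)) (lotState pre d u) j) (allSeqs n (suc r)) ≡
  sumBelow (λ t → tailsFrom n r (suc (length pre)) (lotState pre d u) j (suc (length pre + t))) (suc d + u)
count-orderedTail-byFirst n r pre d u j len = begin
  count (orderedTail ℓ lot j) (allSeqs n (suc r))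
    ≡⟨ count-allSeqs (orderedTail ℓ lot j) n r ⟩
  sumBelow (λ i → first (suc i)) n
    ≡⟨ cong (sumBelow (λ i → first (suc i))) (sym len ⟨ trans ⟩ length-lotState pre d u) ⟩
  sumBelow (λ i → first (suc i)) (length pre + (suc d + u))
    ≡⟨ sumBelow-split (λ i → first (suc i)) (length pre) (suc d + u) ⟩
  sumBelow (λ i → first (suc i)) (length pre) + sumBelow (λ t → first (suc (length pre + t))) (suc d + u)
    ≡⟨ cong (_+ sumBelow (λ t → first (suc (length pre + t))) (suc d + u))
            (sumBelow-zero (length pre) λ i i<len →
               count-false (allSeqs n r) λ s → orderedTail-below {lot = lot} {j} {s} (s≤s i<len)) ⟩
  sumBelow (λ t → first (suc (length pre + t))) (suc d + u) ∎
  where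
  open ≡-Reasoning
  ℓ = suc (length pre)
  lot = lotState pre d u
  first = tailsFrom n r ℓ lot j

count-orderedTail : ∀ n r pre d u j → length (lotState pre d u) ≡ n →
  count (orderedTail (suc (length pre)) (lotState pre d u) j) (allSeqs n r) ≡ nTails r d u j

tailsFrom-inBlock : ∀ n r pre {i e d u j} → i + e ≡ d → length (lotState pre d (suc u)) ≡ n →
  tailsFrom n r (suc (length pre)) (lotState pre d (suc u)) j (suc (length pre + i)) ≡ nTails r (suc e) u j
tailsFrom-inBlock n r pre {i} {e} {u = u} {j} refl len = begin
  tailsFrom n r ℓ lot j (suc (length pre + i))
    ≡⟨ cong (λ x → tailsFrom n r ℓ lot j (suc x)) (length-++-replicate pre i true) ⟨
  tailsFrom n r ℓ lot j (suc (length pre'))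
    ≡⟨ tailsFrom-parks {n} {r} {j = j} (s≤s (length-++-≤ˡ pre)) park ⟩
  count (orderedTail (suc (length pre')) (lotState pre' (suc e) u) j) (allSeqs n r)
    ≡⟨ count-orderedTail n r pre' (suc e) u j (parkFrom-length park ⟨ trans ⟩ len) ⟩
  nTails r (suc e) u j ∎
  where
  open ≡-Reasoning
  ℓ = suc (length pre)
  lot = lotState pre (i + e) (suc u)
  pre' = pre ++ replicate i true
  park = parkFrom-inBlock pre i e u

tailsFrom-inFullBlock : ∀ n r pre {i e d j} → i + e ≡ d → length (lotState pre d 0) ≡ n →
  tailsFrom n r (suc (length pre)) (lotState pre d 0) (suc j) (suc (length pre + i)) ≡ nTails r e 0 j
tailsFrom-inFullBlock n r pre {i} {e} {j = j} refl len = begin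
  tailsFrom n r ℓ lot (suc j) (suc (length pre + i))
    ≡⟨ cong (λ x → tailsFrom n r ℓ lot (suc j) (suc x)) (length-++-replicate pre i true) ⟨
  tailsFrom n r ℓ lot (suc j) (suc (length pre'))
    ≡⟨ tailsFrom-flaw {n} {r} {j = j} (s≤s (length-++-≤ˡ pre)) park ⟩
  count (orderedTail (suc (length pre')) (lotState pre' e 0) j) (allSeqs n r)
    ≡⟨ count-orderedTail n r pre' e 0 j (parkFrom-length park ⟨ trans ⟩ len) ⟩
  nTails r e 0 j ∎
  where
  open ≡-Reasoning
  ℓ = suc (length pre)
  lot = lotState pre (i + e) 0
  pre' = pre ++ replicate i true
  park = parkFrom-inFullBlock pre i e

tailsFrom-inFullBlock-0 : ∀ n r pre {i e d} → i + e ≡ d →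
  tailsFrom n r (suc (length pre)) (lotState pre d 0) 0 (suc (length pre + i)) ≡ 0
tailsFrom-inFullBlock-0 n r pre {i} {e} refl =
  cong (λ x → tailsFrom n r (suc (length pre)) (lotState pre (i + e) 0) 0 (suc x))
       (sym (length-++-replicate pre i true)) ⟨ trans ⟩
  tailsFrom-flaw-0 {n} {r} (s≤s (length-++-≤ˡ pre)) (parkFrom-inFullBlock pre i e)

tailsFrom-inFree : ∀ n r pre {d g w u j} → g + w ≡ u → length (lotState pre d (suc u)) ≡ n →
  tailsFrom n r (suc (length pre)) (lotState pre d (suc u)) j (suc (length pre + (suc d + g))) ≡ nTails r 0 w j
tailsFrom-inFree n r pre {d} {g} {w} {j = j} refl len = begin
  tailsFrom n r ℓ lot j (suc (length pre + (suc d + g)))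
    ≡⟨ cong (λ x → tailsFrom n r ℓ lot j (suc x))
            (length-++ pre ⟨ trans ⟩ cong (_+_ (length pre)) (length-lotState [] d g)) ⟨
  tailsFrom n r ℓ lot j (suc (length pre'))
    ≡⟨ tailsFrom-parks {n} {r} {j = j} (s≤s (length-++-≤ˡ pre)) park ⟩
  count (orderedTail (suc (length pre')) (lotState pre' 0 w) j) (allSeqs n r)
    ≡⟨ count-orderedTail n r pre' 0 w j (parkFrom-length park ⟨ trans ⟩ len) ⟩
  nTails r 0 w j ∎
  where
  open ≡-Reasoning
  ℓ = suc (length pre)
  lot = lotState pre d (suc (g + w))
  pre' = pre ++ (replicate (suc d) true ++ replicate g false)
  park = parkFrom-inFree pre d g w

count-orderedTail n zero pre d u zero len = refl
count-orderedTail n zero pre d u (suc j) len = refl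
count-orderedTail n (suc r) pre d zero zero len =
  count-orderedTail-byFirst n r pre d 0 0 len ⟨ trans ⟩
  cong (sumBelow _) (+-identityʳ (suc d)) ⟨ trans ⟩
  sumBelow-zero (suc d) λ i i<1+d → tailsFrom-inFullBlock-0 n r pre (m+[n∸m]≡n (m<1+n⇒m≤n i<1+d))
count-orderedTail n (suc r) pre d zero (suc j) len =
  count-orderedTail-byFirst n r pre d 0 (suc j) len ⟨ trans ⟩
  cong (sumBelow _) (+-identityʳ (suc d)) ⟨ trans ⟩
  sumBelow-cong (suc d) λ i i<1+d → tailsFrom-inFullBlock n r pre (m+[n∸m]≡n (m<1+n⇒m≤n i<1+d)) len
count-orderedTail n (suc r) pre d (suc u) j len =
  count-orderedTail-byFirst n r pre d (suc u) j len ⟨ trans ⟩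
  sumBelow-split _ (suc d) (suc u) ⟨ trans ⟩
  cong₂ _+_
    (sumBelow-cong (suc d) λ i i<1+d → tailsFrom-inBlock n r pre (m+[n∸m]≡n (m<1+n⇒m≤n i<1+d)) len)
    (sumBelow-cong (suc u) λ g g<1+u → tailsFrom-inFree n r pre (m+[n∸m]≡n (m<1+n⇒m≤n g<1+u)) len)

op-predicate-cons : ∀ n k m a s →
  (isOrdered (a ∷ s) ∧ leadingIs m (a ∷ s) ∧ (k ≤ᵇ flaws n (a ∷ s)) ∧ (flaws n (a ∷ s) ≤ᵇ k)) ≡
  isOrdered (a ∷ s) ∧ (m ≡ᵇ a) ∧ (k ≡ᵇ flaws n (a ∷ s))
op-predicate-cons n k m a s =
  cong (isOrdered (a ∷ s) ∧_) (cong₂ _∧_ (≤ᵇ∧≥ᵇ≡≡ᵇ m a) (≤ᵇ∧≥ᵇ≡≡ᵇ k (flaws n (a ∷ s))))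

op-nTails : ∀ m' u k → op (m' + suc u) k (suc m') ≡ nTails (m' + u) 0 u k
op-nTails m' u k = begin
  op n k m
    ≡⟨ cong (λ r → count P (allSeqs n r)) n≡1+r ⟩
  count P (allSeqs n (suc r))
    ≡⟨ count-allSeqs P n r ⟩
  sumBelow (λ i → count (λ s → P (suc i ∷ s)) (allSeqs n r)) n
    ≡⟨ sumBelow-single n (m<m+n m' (s≤s z≤n)) other ⟩
  count (λ s → P (m ∷ s)) (allSeqs n r)
    ≡⟨ count-cong (allSeqs n r) leading ⟩
  count (orderedTail m (lotState pre 0 u) k) (allSeqs n r)
    ≡⟨ cong (λ ℓ → count (orderedTail ℓ (lotState pre 0 u) k) (allSeqs n r))
            (cong suc (length-replicate m')) ⟨
  count (orderedTail (suc (length pre)) (lotState pre 0 u) k) (allSeqs n r)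
    ≡⟨ count-orderedTail n r pre 0 u k (parkFrom-length park ⟨ trans ⟩ length-emptyLot) ⟩
  nTails r 0 u k ∎
  where
  open ≡-Reasoning
  n = m' + suc u
  m = suc m'
  r = m' + u
  pre = replicate m' false
  P = λ as → isOrdered as ∧ leadingIs m as ∧ (k ≤ᵇ flaws n as) ∧ (flaws n as ≤ᵇ k)
  n≡1+r : n ≡ suc r
  n≡1+r = +-suc m' u
  park = parkFrom-emptyLot m' u
  length-emptyLot : length (emptyLot n) ≡ n
  length-emptyLot = cong length (emptyLot-replicate n) ⟨ trans ⟩ length-replicate n
  other : ∀ j → j < n → j ≢ m' → count (λ s → P (suc j ∷ s)) (allSeqs n r) ≡ 0
  other j _ j≢m' = count-false (allSeqs n r) λ s →
    op-predicate-cons n k m (suc j) s ⟨ trans ⟩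
    cong (λ b → isOrdered (suc j ∷ s) ∧ b ∧ (k ≡ᵇ flaws n (suc j ∷ s)))
         (dec-false (m' ≟ j) (≢-sym j≢m')) ⟨ trans ⟩
    ∧-zeroʳ (isOrdered (suc j ∷ s))
  leading : ∀ s → P (m ∷ s) ≡ orderedTail m (lotState pre 0 u) k s
  leading s =
    op-predicate-cons n k m m s ⟨ trans ⟩
    cong (λ b → isOrdered (m ∷ s) ∧ b ∧ (k ≡ᵇ flaws n (m ∷ s))) (dec-true (m' ≟ m') refl) ⟨ trans ⟩
    orderedWithFlaws-parks {j = k} {s} park


-- Solving the recurrence

nTails-flawStep : ∀ r d j → nTails (suc r) d 0 (suc j) ≡ sumBelow (λ e → nTails r e 0 j) (suc d)
nTails-flawStep r d j = sumBelow-reverse (λ e → nTails r e 0 j) d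

nTails-step : ∀ r d u j → nTails (suc r) d (suc u) j ≡
  sumBelow (λ e → nTails r (suc e) u j) (suc d) + sumBelow (λ v → nTails r 0 v j) (suc u)
nTails-step r d u j =
  cong₂ _+_ (sumBelow-reverse (λ e → nTails r (suc e) u j) d) (sumBelow-reverse (λ v → nTails r 0 v j) u)

nTails-moreFlawsThanCars : ∀ r d u j → r < j → nTails r d u j ≡ 0
nTails-moreFlawsThanCars zero d u (suc j) _ = refl
nTails-moreFlawsThanCars (suc r) d zero (suc j) (s≤s r<j) =
  nTails-flawStep r d j ⟨ trans ⟩ sumBelow-zero (suc d) λ e _ → nTails-moreFlawsThanCars r e 0 j r<j
nTails-moreFlawsThanCars (suc r) d (suc u) j 1+r<j =
  nTails-step r d u j ⟨ trans ⟩
  cong₂ _+_ (sumBelow-zero (suc d) λ e _ → nTails-moreFlawsThanCars r (suc e) u j r<j)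
            (sumBelow-zero (suc u) λ v _ → nTails-moreFlawsThanCars r 0 v j r<j)
  where r<j = <-trans (n<1+n r) 1+r<j

nTails-moreCarsThanRoom : ∀ r d u j → u + j < r → nTails r d u j ≡ 0
nTails-moreCarsThanRoom (suc r) d zero zero _ = refl
nTails-moreCarsThanRoom (suc r) d zero (suc j) (s≤s j<r) =
  nTails-flawStep r d j ⟨ trans ⟩ sumBelow-zero (suc d) λ e _ → nTails-moreCarsThanRoom r e 0 j j<r
nTails-moreCarsThanRoom (suc r) d (suc u) j (s≤s u+j<r) =
  nTails-step r d u j ⟨ trans ⟩
  cong₂ _+_ (sumBelow-zero (suc d) λ e _ → nTails-moreCarsThanRoom r (suc e) u j u+j<r)
            (sumBelow-zero (suc u) λ v v<1+u →
               nTails-moreCarsThanRoom r 0 v j (≤-<-trans (+-monoˡ-≤ j (m<1+n⇒m≤n v<1+u)) u+j<r))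

nTails-full : ∀ j d → nTails j d 0 j ≡ (j + d) C d
nTails-full zero d = sym (nCn≡1 d)
nTails-full (suc j) d = begin
  nTails (suc j) d 0 (suc j)
    ≡⟨ nTails-flawStep j d j ⟩
  sumBelow (λ e → nTails j e 0 j) (suc d)
    ≡⟨ sumBelow-cong (suc d) (λ e _ → nTails-full j e) ⟩
  sumBelow (λ e → shiftC 1 (j + e) (suc (0 + e))) (suc d)
    ≡⟨ +-identityʳ _ ⟨
  sumBelow (λ e → shiftC 1 (j + e) (suc (0 + e))) (suc d) + 0
    ≡⟨ diagonal-hockeyStick {shiftC 1} (shiftC-pascal 1) j 0 (suc d) ⟩
  (j + suc d) C d
    ≡⟨ cong (_C d) (+-suc j d) ⟩
  (suc j + d) C d ∎
  where open ≡-Reasoning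

nTails-exact : ∀ u j d → nTails (u + j) d u j + shiftC 2 (u + u + j + d) u ≡ (u + u + j + d) C (u + d)
nTails-exact zero j d = +-identityʳ _ ⟨ trans ⟩ nTails-full j d
nTails-exact (suc u) j d = begin
  nTails (suc (u + j)) d (suc u) j + shiftC 2 (suc u + suc u + j + d) (suc u)
    ≡⟨ cong₂ _+_ split (cong (λ x → shiftC 2 x (suc u)) index) ⟩
  sumBelow T D + shiftC 2 (K + D) (suc u)
    ≡⟨ cong (_+_ (sumBelow T D)) (column-hockeyStick {shiftC 2} (shiftC-pascal 2) K u D) ⟨
  sumBelow T D + (sumBelow (λ e → shiftC 2 (K + e) u) D + shiftC 1 K u)
    ≡⟨ +-assoc (sumBelow T D) _ _ ⟨
  sumBelow T D + sumBelow (λ e → shiftC 2 (K + e) u) D + shiftC 1 K u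
    ≡⟨ cong (_+ shiftC 1 K u) (sumBelow-+ D λ e _ → nTails-exact u j e) ⟩
  sumBelow (λ e → (K + e) C (u + e)) D + shiftC 1 K u
    ≡⟨ diagonal-hockeyStick {shiftC 1} (shiftC-pascal 1) K u D ⟩
  shiftC 1 (K + D) (u + D)
    ≡⟨ cong₂ (shiftC 1) (sym index) (+-suc u (suc d) ⟨ trans ⟩ cong suc (+-suc u d)) ⟩
  (suc u + suc u + j + d) C (suc u + d) ∎
  where
  open ≡-Reasoning
  K = u + u + j
  D = suc (suc d)
  T = λ e → nTails (u + j) e u j
  index : suc u + suc u + j + d ≡ K + D
  index = rearrange u j d
    where
    rearrange : ∀ u j d → suc u + suc u + j + d ≡ u + u + j + suc (suc d)
    rearrange = solve-∀
  split : nTails (suc (u + j)) d (suc u) j ≡ sumBelow T D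
  split = begin
    nTails (suc (u + j)) d (suc u) j
      ≡⟨ nTails-step (u + j) d u j ⟩
    sumBelow (λ e → T (suc e)) (suc d) + sumBelow (λ v → nTails (u + j) 0 v j) (suc u)
      ≡⟨ cong (_+_ (sumBelow (λ e → T (suc e)) (suc d))) (sumBelow-single (suc u) ≤-refl λ v v<1+u v≢u →
           nTails-moreCarsThanRoom (u + j) 0 v j (+-monoˡ-< j (≤∧≢⇒< (m<1+n⇒m≤n v<1+u) v≢u))) ⟩
    sumBelow (λ e → T (suc e)) (suc d) + T 0
      ≡⟨ +-comm _ (T 0) ⟩
    T 0 + sumBelow (λ e → T (suc e)) (suc d)
      ≡⟨ sumBelow-suc T (suc d) ⟨
    sumBelow T D ∎

nTails-exact-boundary : ∀ p j →
  nTails (p + j) 0 p j + shiftC 2 (suc (p + p + j)) (suc p) ≡ shiftC 1 (suc (p + p + j)) (suc p)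
nTails-exact-boundary p j = begin
  T₀ + shiftC 1 (suc a) p                 ≡⟨ cong (_+_ T₀) (shiftC-suc 1 a p) ⟩
  T₀ + (shiftC 1 a p + shiftC 2 a p)      ≡⟨ x∙yz≈xz∙y T₀ (shiftC 1 a p) _ ⟩
  T₀ + shiftC 2 a p + shiftC 1 a p        ≡⟨ cong (_+ shiftC 1 a p) exact ⟩
  a C p + shiftC 1 a p                    ≡⟨ shiftC-suc 0 a p ⟨
  suc a C p                               ∎
  where
  open ≡-Reasoning
  a = p + p + j
  T₀ = nTails (p + j) 0 p j
  exact : T₀ + shiftC 2 a p ≡ a C p
  exact = subst₂ (λ x y → T₀ + shiftC 2 x p ≡ x C y) (+-identityʳ a) (+-identityʳ p) (nTails-exact p j 0)

nTails-spare : ∀ p d w j {N} → 1 ≤ j → suc (p + w) + p + j + d ≡ N →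
  nTails (p + j) d (suc (p + w)) j + shiftC 2 N p ≡ shiftC 1 N p
nTails-spare zero d w (suc j) _ refl =
  +-identityʳ _ ⟨ trans ⟩ nTails-step j d w (suc j) ⟨ trans ⟩
  cong₂ _+_ (sumBelow-zero (suc d) λ e _ → nTails-moreFlawsThanCars j (suc e) w (suc j) ≤-refl)
            (sumBelow-zero (suc w) λ v _ → nTails-moreFlawsThanCars j 0 v (suc j) ≤-refl)
-- Split by the first car: it prefers an occupied space (E) or a free space with v free spaces
-- after it, where v < p gives no tails, v = p is the exact case T₀ and v > p gives E′.  Column
-- sums of C(·, p − 1) and C(·, p − 2) then reassemble the binomials.
nTails-spare (suc p) d w j {N} 1≤j N≡ = begin
  nTails (suc (p + j)) d (suc U) j + shiftC 2 N (suc p)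
    ≡⟨ cong₂ _+_ split (cong (λ x → shiftC 2 x (suc p)) (sym L+W+D≡N)) ⟩
  (sumBelow E D + (sumBelow E′ W + T₀)) + shiftC 2 (L + W + D) (suc p)
    ≡⟨ cong (_+_ (sumBelow E D + (sumBelow E′ W + T₀)))
            (column-hockeyStick-split {shiftC 2} (shiftC-pascal 2) L W D p) ⟩
  (sumBelow E D + (sumBelow E′ W + T₀)) +
  (sumBelow (λ e → shiftC 2 (L + W + e) p) D + (sumBelow (λ i → shiftC 2 (L + i) p) W + shiftC 2 L (suc p)))
    ≡⟨ +-combine₃ {sumBelow E D} {sumBelow E′ W} {T₀}
         (sumBelow-+ {E} D λ e _ → nTails-spare p (suc e) w j 1≤j (blockIndex e))
         (sumBelow-+ {E′} W λ i _ → nTails-spare p 0 i j 1≤j (freeIndex i))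
         (nTails-exact-boundary p j) ⟩
  sumBelow (λ e → shiftC 1 (L + W + e) p) D + (sumBelow (λ i → shiftC 1 (L + i) p) W + shiftC 1 L (suc p))
    ≡⟨ column-hockeyStick-split {shiftC 1} (shiftC-pascal 1) L W D p ⟨
  shiftC 1 (L + W + D) (suc p)
    ≡⟨ cong (λ x → shiftC 1 x (suc p)) L+W+D≡N ⟩
  shiftC 1 N (suc p) ∎
  where
  open ≡-Reasoning
  U = suc (p + w)
  L = suc (p + p + j)
  W = suc w
  D = suc d
  E = λ e → nTails (p + j) (suc e) U j
  E′ = λ i → nTails (p + j) 0 (suc (p + i)) j
  T₀ = nTails (p + j) 0 p j
  L+W+D≡N : L + W + D ≡ N
  L+W+D≡N = rearrange p w j d ⟨ trans ⟩ N≡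
    where
    rearrange : ∀ p w j d → suc (p + p + j) + suc w + suc d ≡ suc (suc p + w) + suc p + j + d
    rearrange = solve-∀
  blockIndex : ∀ e → U + p + j + suc e ≡ L + W + e
  blockIndex = rearrange p w j
    where
    rearrange : ∀ p w j e → suc (p + w) + p + j + suc e ≡ suc (p + p + j) + suc w + e
    rearrange = solve-∀
  freeIndex : ∀ i → suc (p + i) + p + j + 0 ≡ L + i
  freeIndex = rearrange p j
    where
    rearrange : ∀ p j i → suc (p + i) + p + j + 0 ≡ suc (p + p + j) + i
    rearrange = solve-∀
  free : sumBelow (λ v → nTails (p + j) 0 v j) (suc U) ≡ sumBelow E′ W + T₀
  free = begin
    sumBelow g (suc U)
      ≡⟨ cong (sumBelow g) (+-suc p (suc w) ⟨ trans ⟩ cong suc (+-suc p w)) ⟨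
    sumBelow g (p + suc W)
      ≡⟨ sumBelow-split g p (suc W) ⟩
    sumBelow g p + sumBelow (λ i → g (p + i)) (suc W)
      ≡⟨ cong (_+ sumBelow (λ i → g (p + i)) (suc W)) (sumBelow-zero p λ v v<p →
           nTails-moreCarsThanRoom (p + j) 0 v j (+-monoˡ-< j v<p)) ⟩
    sumBelow (λ i → g (p + i)) (suc W)
      ≡⟨ sumBelow-suc (λ i → g (p + i)) W ⟩
    g (p + 0) + sumBelow (λ i → g (p + suc i)) W
      ≡⟨ cong₂ _+_ (cong g (+-identityʳ p)) (sumBelow-cong W λ i _ → cong g (+-suc p i)) ⟩
    T₀ + sumBelow E′ W
      ≡⟨ +-comm T₀ _ ⟩
    sumBelow E′ W + T₀ ∎
    where g = λ v → nTails (p + j) 0 v j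
  split : nTails (suc (p + j)) d (suc U) j ≡ sumBelow E D + (sumBelow E′ W + T₀)
  split = nTails-step (p + j) d U j ⟨ trans ⟩ cong (_+_ (sumBelow E D)) free

ballot-binomℤ : ∀ N p h c → h + shiftC 2 N p ≡ shiftC 1 N p → c + p + p ≡ 3 + N →
                h * suc N ≡ c * binomℤ (suc N) (p ⊖ 1)
ballot-binomℤ N zero h c difference _ =
  cong (_* suc N) (sym (+-identityʳ h) ⟨ trans ⟩ difference) ⟨ trans ⟩ sym (*-zeroʳ c)
ballot-binomℤ N (suc q) h c difference total =
  ballot N q h c difference (suc-injective (suc-injective (rearrange c q ⟨ trans ⟩ total)))
  where
  rearrange : ∀ c q → 2 + (c + q + q) ≡ c + suc q + suc q
  rearrange = solve-∀

op-binomialDifference : ∀ m' w p → let k = suc m' + w; N = p + p + k + suc w in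
  op (k + 1 + p) k (suc m') + shiftC 2 N p ≡ shiftC 1 N p
op-binomialDifference m' w p =
  cong (_+ shiftC 2 (p + p + k + suc w) p)
       (cong (λ n → op n k (suc m')) (n-index m' w p) ⟨ trans ⟩ op-nTails m' (suc (p + w)) k ⟨ trans ⟩
        cong (λ r → nTails r 0 (suc (p + w)) k) (r-index m' w p)) ⟨ trans ⟩
  nTails-spare p 0 w k (s≤s z≤n) (N-index m' w p)
  where
  k = suc m' + w
  n-index : ∀ m' w p → suc m' + w + 1 + p ≡ m' + suc (suc (p + w))
  n-index = solve-∀
  r-index : ∀ m' w p → m' + suc (p + w) ≡ p + (suc m' + w)
  r-index = solve-∀
  N-index : ∀ m' w p → suc (p + w) + p + (suc m' + w) + 0 ≡ p + p + (suc m' + w) + suc w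
  N-index = solve-∀

mainTheorem6 : (n k m : ℕ) → 1 ≤ m → m ≤ k → k + 1 ≤ n →
    op n k m * (2 * n ∸ m) ≡ (2 * k + 4 ∸ m) * binomℤ (2 * n ∸ m) (+ n - + (k + 2))
mainTheorem6 n k (suc m') (s≤s z≤n) m≤k k+1≤n with m≤n⇒∃[o]m+o≡n m≤k | m≤n⇒∃[o]m+o≡n k+1≤n
... | w , refl | p , refl = begin
  op n k m * (2 * n ∸ m)
    ≡⟨ cong (op n k m *_) 2n∸m≡1+N ⟩
  op n k m * suc N
    ≡⟨ ballot-binomℤ N p (op n k m) c (op-binomialDifference m' w p) c+2p≡3+N ⟩
  c * binomℤ (suc N) (p ⊖ 1)
    ≡⟨ cong₂ (λ x y → c * binomℤ x y) (sym 2n∸m≡1+N) (sym lowerIndex) ⟩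
  c * binomℤ (2 * n ∸ m) (+ n - + (k + 2)) ∎
  where
  open ≡-Reasoning
  m = suc m'
  N = p + p + k + suc w
  c = 2 * k + 4 ∸ m
  2n∸m≡1+N : 2 * n ∸ m ≡ suc N
  2n∸m≡1+N = cong (_∸ m) (rearrange m' w p) ⟨ trans ⟩ m+n∸m≡n m (suc N)
    where
    rearrange : ∀ m' w p → 2 * (suc m' + w + 1 + p) ≡ suc m' + suc (p + p + (suc m' + w) + suc w)
    rearrange = solve-∀
  c+2p≡3+N : c + p + p ≡ 3 + N
  c+2p≡3+N = cong (λ x → x ∸ m + p + p) (rearrange₁ m' w) ⟨ trans ⟩
             cong (λ x → x + p + p) (m+n∸m≡n m (m' + w + w + 5)) ⟨ trans ⟩ rearrange₂ m' w p
    where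
    rearrange₁ : ∀ m' w → 2 * (suc m' + w) + 4 ≡ suc m' + (m' + w + w + 5)
    rearrange₁ = solve-∀
    rearrange₂ : ∀ m' w p → m' + w + w + 5 + p + p ≡ 3 + (p + p + (suc m' + w) + suc w)
    rearrange₂ = solve-∀
  lowerIndex : + n - + (k + 2) ≡ p ⊖ 1
  lowerIndex = [+m]-[+n]≡m⊖n n (k + 2) ⟨ trans ⟩ cong (_⊖ (k + 2)) (+-assoc k 1 p) ⟨ trans ⟩
               +-cancelˡ-⊖ k (suc p) 2 ⟨ trans ⟩ [1+m]⊖[1+n]≡m⊖n p 1
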